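{- Let $n\ge3$ and let $\tilde{\mathbf{C}}_n$ be the graph on vertices $0,1,\dots,n$ with a double edge from the longer vertex $0$ to the shorter vertex $1$, simple edges $1-2,\dots,(n-2)-(n-1)$, and a double edge from the longer vertex $n$ to the shorter vertex $n-1$. Then $\#\mathrm{Cl}(\tilde{\mathbf{C}}_n)=2n+2$. Writing labelings as $(c_0;c_1,\dots,c_{n-1};c_n)$, a set of minimal representatives of the classes is: (1) $c_0=c_n=0$ and $(c_1,\dots,c_{n-1})=\xi_i^{n-1}$ for $i=0,\dots,\lceil (n-1)/2\rceil$; (2) $c_0=0$, $c_n=1$, $c_{n-1}=0$, $(c_1,\dots,c_{n-2})=\eta_i^{n-2}$ for $i=0,\dots,\lceil (n-2)/2\rceil$; (3) $c_0=1$, $c_n=0$, $c_1=0$, $(c_2,\dots,c_{n-1})=\xi_i^{n-2}$ for $i=0,\dots,\lceil(n-2)/2\rceil$; (4) $c_0=c_n=1$, $c_1=c_{n-1}=0$, $(c_2,\dots,c_{n-2})=\xi_i^{n-3}$ for $i=0,\dots,\lceil(n-3)/2\rceil$; and (5) the labeling with all labels equal to $1$.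
   Context: Generalized Reeder's puzzle: a labeling assigns $c_j\in\mathbb{Z}/2\mathbb{Z}$ to each vertex $j$. Double edges are directed from a longer to a shorter vertex. The move $T_i$ replaces $c_i$ by $c_i+\sum_k c_k\pmod 2$, where $k$ runs over neighbors of $i$ excluding any neighbor that is the shorter endpoint of a double edge at $i$; other labels are unchanged. Equivalence is generated by moves; $\mathrm{Cl}(D)$ is the set of classes; a minimal representative is a labeling in its class with the fewest $1$'s. For a sequence of $m$ consecutive path vertices listed in order, $\xi_r^m$ denotes the labeling with $1$'s exactly at positions $1,3,\dots,2r-1$ and $\eta_r^m$ the labeling with $1$'s exactly at positions $m,m-2,\dots,m-2(r-1)$. -}

module Defs where

open import Data.Nat using (ℕ; zero; suc; _+_; _∸_; _*_; _≤_; _≡ᵇ_; _≤ᵇ_; _<ᵇ_; ⌈_/2⌉)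
open import Data.Nat.Base using (_%_)
open import Data.Bool using (Bool; true; false; _∧_; _∨_; not; _xor_; if_then_else_)
open import Data.Fin using (Fin; toℕ; _≟_) renaming (zero to fzero; suc to fsuc)
open import Data.Vec using (Vec; []; _∷_; tabulate; lookup)
open import Data.List using (List; [_]; _++_; map; upTo; sum; length)
open import Data.Product using (∃)
open import Relation.Nullary.Decidable using (⌊_⌋)
open import Relation.Binary.PropositionalEquality using (_≡_)
open import Relation.Binary.Construct.Closure.Equivalence using (EqClosure)

-- ℤ/2ℤ is modelled by Bool with _xor_ as addition (true = 1).

-- A graph with (possibly) double edges on the vertex set Fin m.
--   adj i k : i and k are joined by an edge (simple or double); symmetric.
--   dbl i k : there is a double edge directed from the longer vertex i
--             to the shorter vertex k.
record DGraph (m : ℕ) : Set where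
  field
    adj : Fin m → Fin m → Bool
    dbl : Fin m → Fin m → Bool
open DGraph public

Labeling : ℕ → Set
Labeling m = Vec Bool m

xorSum : ∀ {m} → (Fin m → Bool) → Bool
xorSum {zero} f = false
xorSum {suc m} f = f fzero xor xorSum (λ k → f (fsuc k))

move : ∀ {m} → DGraph m → Fin m → Labeling m → Labeling m
move G i c = tabulate λ j →
  if ⌊ j ≟ i ⌋
  then lookup c i xor xorSum (λ k → adj G i k ∧ not (dbl G i k) ∧ lookup c k)
  else lookup c j

Step : ∀ {m} → DGraph m → Labeling m → Labeling m → Set
Step G c d = ∃ λ i → d ≡ move G i c

_∼⟨_⟩_ : ∀ {m} → Labeling m → DGraph m → Labeling m → Set
c ∼⟨ G ⟩ d = EqClosure (Step G) c d

weight : ∀ {m} → Labeling m → ℕ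
weight [] = 0
weight (b ∷ v) = (if b then 1 else 0) + weight v

Ctilde : (n : ℕ) → DGraph (suc n)
Ctilde n = record
  { adj = λ i k → (suc (toℕ i) ≡ᵇ toℕ k) ∨ (suc (toℕ k) ≡ᵇ toℕ i)
  ; dbl = λ i k → ((toℕ i ≡ᵇ 0) ∧ (toℕ k ≡ᵇ 1))
                ∨ ((toℕ i ≡ᵇ n) ∧ (toℕ k ≡ᵇ n ∸ 1))
  }

-- ξ_r^m at position p (1 ≤ p ≤ m): 1's exactly at positions 1,3,…,2r-1.
xi : (r m p : ℕ) → Bool
xi r m p = (p % 2 ≡ᵇ 1) ∧ (1 ≤ᵇ p) ∧ (p ≤ᵇ 2 * r ∸ 1) ∧ (p ≤ᵇ m)

-- η_r^m at position p (1 ≤ p ≤ m): 1's exactly at positions m,m-2,…,m-2(r-1).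
eta : (r m p : ℕ) → Bool
eta r m p = (1 ≤ᵇ p) ∧ (p ≤ᵇ m) ∧ ((m ∸ p) % 2 ≡ᵇ 0) ∧ (m ∸ p <ᵇ 2 * r)

mkLab : (n : ℕ) → (ℕ → Bool) → Labeling (suc n)
mkLab n f = tabulate (λ j → f (toℕ j))

rep1 : (n i : ℕ) → Labeling (suc n)
rep1 n i = mkLab n λ j →
  if (j ≡ᵇ 0) ∨ (j ≡ᵇ n) then false else xi i (n ∸ 1) j

rep2 : (n i : ℕ) → Labeling (suc n)
rep2 n i = mkLab n λ j →
  if j ≡ᵇ 0 then false else
  if j ≡ᵇ n then true else
  if j ≡ᵇ n ∸ 1 then false else eta i (n ∸ 2) j

rep3 : (n i : ℕ) → Labeling (suc n)
rep3 n i = mkLab n λ j →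
  if j ≡ᵇ 0 then true else
  if j ≡ᵇ n then false else
  if j ≡ᵇ 1 then false else xi i (n ∸ 2) (j ∸ 1)

rep4 : (n i : ℕ) → Labeling (suc n)
rep4 n i = mkLab n λ j →
  if (j ≡ᵇ 0) ∨ (j ≡ᵇ n) then true else
  if (j ≡ᵇ 1) ∨ (j ≡ᵇ n ∸ 1) then false else xi i (n ∸ 3) (j ∸ 1)

rep5 : (n : ℕ) → Labeling (suc n)
rep5 n = mkLab n (λ _ → true)

reps : (n : ℕ) → List (Labeling (suc n))
reps n =  map (rep1 n) (upTo (suc ⌈ n ∸ 1 /2⌉))
       ++ map (rep2 n) (upTo (suc ⌈ n ∸ 2 /2⌉))
       ++ map (rep3 n) (upTo (suc ⌈ n ∸ 2 /2⌉))
       ++ map (rep4 n) (upTo (suc ⌈ n ∸ 3 /2⌉))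
       ++ [ rep5 n ]

module Submission where

-- For 0 < i < n the move T_i replaces c_i by c_{i-1} + c_i + c_{i+1}, which
-- exchanges the adjacent differences d_{i-1}, d_i of the word d_k = c_k + c_{k+1};
-- T_0 and T_n are trivial, because there the only neighbour is the shorter end of
-- a double edge.  Adjacent exchanges sort any word, so the class of c is
-- determined by c_0 and the number k ≤ n of jumps d_k = 1, giving 2n + 2 classes.
-- The jumps cut c into k + 1 constant runs of alternating value, of which ⌈k/2⌉
-- (if c_0 = 0) or ⌊k/2⌋ + 1 (if c_0 = 1) consist of ones.  The listed
-- representatives attain these bounds, except in the class (1, 0), whose only
-- member is the all-ones labeling.

open import Defs
open import Data.Nat using (ℕ; suc; _+_; _*_; _≤_)
open import Data.Fin using (Fin)
open import Data.List using (length; lookup)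
open import Data.Product using (_×_; ∃)
open import Relation.Binary.PropositionalEquality using (_≡_)

open import Algebra.Bundles using (CommutativeRing)
open import Data.Bool using (Bool; true; false; _∧_; _∨_; not; _xor_; if_then_else_; T)
open import Data.Bool.Properties using (∧-zeroʳ; ∧-identityʳ; ∨-zeroʳ; xor-identityʳ; xor-assoc; xor-same; xor-∧-commutativeRing)
open import Algebra.Properties.CommutativeSemigroup (CommutativeRing.+-commutativeSemigroup xor-∧-commutativeRing)
  using (interchange; xy∙z≈xz∙y; x∙yz≈z∙xy)
open import Data.Empty using (⊥-elim)
import Data.Fin as Fin
open import Data.Fin using (toℕ; fromℕ<) renaming (zero to fzero; suc to fsuc)
open import Data.Fin.Properties using (toℕ≤pred[n]; toℕ-fromℕ<)
open import Data.List as L using (List; []; _∷_; applyUpTo)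
open import Data.List.Properties
  using (length-++; length-map; length-upTo; length-applyUpTo; applyUpTo-∷ʳ; reverse-applyUpTo; unfold-reverse; reverse-++; ++-assoc; ++-identityʳ)
open import Data.List.Membership.Propositional.Properties using (∈-lookup)
open import Data.List.Relation.Unary.All as All using (All)
open import Data.List.Relation.Unary.Any as Any using (Any; here)
open import Data.List.Relation.Unary.AllPairs as AP using (AllPairs)
import Data.List.Relation.Unary.All.Properties as AllP
import Data.List.Relation.Unary.Any.Properties as AnyP
import Data.List.Relation.Unary.AllPairs.Properties as APP
open import Data.Nat using (zero; _∸_; _%_; _<_; _<ᵇ_; _≡ᵇ_; _≟_; _<?_; ⌊_/2⌋; ⌈_/2⌉; z≤n; s≤s; s≤s⁻¹)
open import Data.Nat.Properties
  using ( suc-injective; +-suc; +-identityʳ; +-comm; ≤-refl; ≤-reflexive; ≤-trans; <-trans; n≤1+n; n<1+n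
        ; <⇒≤; <⇒≢; ≮⇒≥; ≤∧≢⇒<; m<n⇒m<1+n; m≤n⇒m<n∨m≡n; m≤m+n; m≢1+m+n; m+n∸m≡n; m+[n∸m]≡n
        ; +-∸-assoc; ∸-+-assoc; ∸-monoˡ-≤; ≡ᵇ⇒≡; ≤⇒≤ᵇ; ⌊n/2⌋+⌈n/2⌉≡n; module ≤-Reasoning )
open import Data.Nat.Tactic.RingSolver using (solve-∀)
open import Data.Product using (_,_; proj₁; proj₂)
open import Data.Product.Properties using (,-injectiveˡ; ,-injectiveʳ)
open import Data.Sum using (_⊎_; inj₁; inj₂)
open import Data.Vec as V using (Vec; []; _∷_; tabulate; toList)
open import Data.Vec.Properties using (toList-injective; cast-is-id; length-toList)
open import Function using (_∘_; id)
open import Relation.Binary.Construct.Closure.Equivalence using (gfold; symmetric)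
open import Relation.Binary.Construct.Closure.ReflexiveTransitive as Star using (Star; ε; _◅_; _◅◅_)
open import Relation.Binary.Construct.Closure.Symmetric using (fwd)
open import Relation.Binary.PropositionalEquality
  using (_≢_; refl; sym; trans; cong; cong₂; subst; isEquivalence; module ≡-Reasoning)
open import Relation.Nullary.Decidable using (⌊_⌋; ⌊⌋-map′; yes; no)

T⇒≡true : ∀ {b} → T b → b ≡ true
T⇒≡true {true} _ = refl

≡ᵇ-refl : ∀ m → (m ≡ᵇ m) ≡ true
≡ᵇ-refl zero = refl
≡ᵇ-refl (suc m) = ≡ᵇ-refl m

≡ᵇ-sym : ∀ m n → (m ≡ᵇ n) ≡ (n ≡ᵇ m)
≡ᵇ-sym zero zero = refl
≡ᵇ-sym zero (suc n) = refl
≡ᵇ-sym (suc m) zero = refl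
≡ᵇ-sym (suc m) (suc n) = ≡ᵇ-sym m n

≡ᵇ-true⇒≡ : ∀ {m n} → (m ≡ᵇ n) ≡ true → m ≡ n
≡ᵇ-true⇒≡ {m} {n} eq = ≡ᵇ⇒≡ m n (subst T (sym eq) _)

≡⇒≡ᵇ-true : ∀ {m n} → m ≡ n → (m ≡ᵇ n) ≡ true
≡⇒≡ᵇ-true {m} refl = ≡ᵇ-refl m

≢⇒≡ᵇ-false : ∀ {m n} → m ≢ n → (m ≡ᵇ n) ≡ false
≢⇒≡ᵇ-false {m} {n} m≢n with m ≡ᵇ n in eq
... | true  = ⊥-elim (m≢n (≡ᵇ-true⇒≡ eq))
... | false = refl

does-≟ : ∀ {m} (k i : Fin m) → ⌊ k Fin.≟ i ⌋ ≡ (toℕ k ≡ᵇ toℕ i)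
does-≟ fzero    fzero    = refl
does-≟ fzero    (fsuc i) = refl
does-≟ (fsuc k) fzero    = refl
does-≟ (fsuc k) (fsuc i) = trans (⌊⌋-map′ _ _ (k Fin.≟ i)) (does-≟ k i)

if-same : ∀ b (x : Bool) → (if b then x else x) ≡ x
if-same true  x = refl
if-same false x = refl

xor-cancelˡ : ∀ x y → x xor (x xor y) ≡ y
xor-cancelˡ x y = trans (sym (xor-assoc x x y)) (cong (_xor y) (xor-same x))

applyUpTo-cong : ∀ {A : Set} m {f g : ℕ → A} → (∀ k → k < m → f k ≡ g k) →
                 applyUpTo f m ≡ applyUpTo g m
applyUpTo-cong zero    f≗g = refl
applyUpTo-cong (suc m) f≗g = cong₂ _∷_ (f≗g 0 (s≤s z≤n)) (applyUpTo-cong m (λ k k<m → f≗g (suc k) (s≤s k<m)))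

applyUpTo-const : ∀ {A : Set} m (b : A) → applyUpTo (λ _ → b) m ≡ L.replicate m b
applyUpTo-const zero    b = refl
applyUpTo-const (suc m) b = cong (b ∷_) (applyUpTo-const m b)

applyDownFrom≡applyUpTo : ∀ {A : Set} (f : ℕ → A) n → L.applyDownFrom f n ≡ applyUpTo (λ k → f (n ∸ suc k)) n
applyDownFrom≡applyUpTo f zero    = refl
applyDownFrom≡applyUpTo f (suc n) = cong (f n ∷_) (applyDownFrom≡applyUpTo f n)

length-map-upTo : ∀ {A : Set} (f : ℕ → A) N → L.length (L.map f (L.upTo N)) ≡ N
length-map-upTo f N = trans (length-map f (L.upTo N)) (length-upTo N)

All-upTo : ∀ {A : Set} (P : A → Set) (f : ℕ → A) N → (∀ i → i < N → P (f i)) → All P (L.map f (L.upTo N))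
All-upTo P f N Pf = AllP.map⁺ (AllP.applyUpTo⁺₁ id N (λ {i} → Pf i))

Any-upTo : ∀ {A : Set} (P : A → Set) (f : ℕ → A) {N} i → i < N → P (f i) → Any P (L.map f (L.upTo N))
Any-upTo P f i i<N Pfi = AnyP.map⁺ (AnyP.applyUpTo⁺ id Pfi i<N)

AllPairs-upTo : ∀ {A B : Set} (g : A → B) (f : ℕ → A) N → (∀ {i j} → i < N → j < N → g (f i) ≡ g (f j) → i ≡ j) →
                AllPairs (λ x y → g x ≢ g y) (L.map f (L.upTo N))
AllPairs-upTo g f N inj = APP.map⁺ (APP.applyUpTo⁺₁ id N (λ i<j j<N eq → <⇒≢ i<j (inj (<-trans i<j j<N) j<N eq)))

lookup-injective : ∀ {A B : Set} (f : A → B) {xs : List A} → AllPairs (λ x y → f x ≢ f y) xs →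
                   ∀ i j → f (L.lookup xs i) ≡ f (L.lookup xs j) → i ≡ j
lookup-injective f (_   AP.∷ _)   fzero    fzero    _  = refl
lookup-injective f (fx≢ AP.∷ _)   fzero    (fsuc j) eq = ⊥-elim (All.lookup fx≢ (∈-lookup j) eq)
lookup-injective f (fx≢ AP.∷ _)   (fsuc i) fzero    eq = ⊥-elim (All.lookup fx≢ (∈-lookup i) (sym eq))
lookup-injective f (_   AP.∷ fxs) (fsuc i) (fsuc j) eq = cong fsuc (lookup-injective f fxs i j eq)

at : ∀ {m} → Vec Bool m → ℕ → Bool
at []      _       = false
at (x ∷ c) zero    = x
at (x ∷ c) (suc p) = at c p

lookup≡at : ∀ {m} (c : Vec Bool m) k → V.lookup c k ≡ at c (toℕ k)
lookup≡at (x ∷ c) fzero    = refl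
lookup≡at (x ∷ c) (fsuc k) = lookup≡at c k

toList-tabulate : ∀ {A : Set} m {f : Fin m → A} (g : ℕ → A) → (∀ k → f k ≡ g (toℕ k)) →
                  toList (tabulate f) ≡ applyUpTo g m
toList-tabulate zero    g f≗g = refl
toList-tabulate (suc m) g f≗g = cong₂ _∷_ (f≗g fzero) (toList-tabulate m (g ∘ suc) (f≗g ∘ fsuc))

toList≡applyUpTo-at : ∀ {m} (c : Vec Bool m) → toList c ≡ applyUpTo (at c) m
toList≡applyUpTo-at []      = refl
toList≡applyUpTo-at (x ∷ c) = cong (x ∷_) (toList≡applyUpTo-at c)

toList-mkLab : ∀ n f → toList (mkLab n f) ≡ applyUpTo f (suc n)
toList-mkLab n f = toList-tabulate (suc n) f (λ _ → refl)

xorUpTo : (ℕ → Bool) → ℕ → Bool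
xorUpTo g zero    = false
xorUpTo g (suc m) = g 0 xor xorUpTo (g ∘ suc) m

xorSum≡xorUpTo : ∀ m {f : Fin m → Bool} (g : ℕ → Bool) → (∀ k → f k ≡ g (toℕ k)) →
                 xorSum f ≡ xorUpTo g m
xorSum≡xorUpTo zero    g f≗g = refl
xorSum≡xorUpTo (suc m) g f≗g = cong₂ _xor_ (f≗g fzero) (xorSum≡xorUpTo m (g ∘ suc) (f≗g ∘ fsuc))

xorUpTo-cong : ∀ m {g h : ℕ → Bool} → (∀ p → p < m → g p ≡ h p) → xorUpTo g m ≡ xorUpTo h m
xorUpTo-cong zero    g≗h = refl
xorUpTo-cong (suc m) g≗h = cong₂ _xor_ (g≗h 0 (s≤s z≤n)) (xorUpTo-cong m (λ p p<m → g≗h (suc p) (s≤s p<m)))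

xorUpTo-false : ∀ m {g : ℕ → Bool} → (∀ p → p < m → g p ≡ false) → xorUpTo g m ≡ false
xorUpTo-false zero    g≗0 = refl
xorUpTo-false (suc m) g≗0 rewrite g≗0 0 (s≤s z≤n) = xorUpTo-false m (λ p p<m → g≗0 (suc p) (s≤s p<m))

xorUpTo-xor : ∀ m (g h : ℕ → Bool) → xorUpTo (λ p → g p xor h p) m ≡ xorUpTo g m xor xorUpTo h m
xorUpTo-xor zero    g h = refl
xorUpTo-xor (suc m) g h =
  trans (cong ((g 0 xor h 0) xor_) (xorUpTo-xor m (g ∘ suc) (h ∘ suc)))
        (interchange (g 0) (h 0) (xorUpTo (g ∘ suc) m) (xorUpTo (h ∘ suc) m))

xorUpTo-select : ∀ m a (v : ℕ → Bool) → a < m → xorUpTo (λ p → (p ≡ᵇ a) ∧ v p) m ≡ v a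
xorUpTo-select (suc m) zero    v _ =
  trans (cong (v 0 xor_) (xorUpTo-false m (λ _ _ → refl))) (xor-identityʳ (v 0))
xorUpTo-select (suc m) (suc a) v (s≤s a<m) = xorUpTo-select m a (λ p → v (suc p)) a<m

-- The moves of C̃_n on words

-- T_I on the word c_0 … c_n; it fixes the word when I = 0 or c_I is the last letter.
localMove : ℕ → List Bool → List Bool
localMove (suc zero)    (a ∷ b ∷ c ∷ r) = a ∷ (a xor b xor c) ∷ c ∷ r
localMove (suc (suc j)) (a ∷ r)         = a ∷ localMove (suc j) r
localMove _             l               = l

localMove-beyond : ∀ j (l : List Bool) → L.length l ≤ suc j → localMove j l ≡ l
localMove-beyond zero          l               _          = refl
localMove-beyond (suc zero)    []              _          = refl
localMove-beyond (suc zero)    (a ∷ [])        _          = refl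
localMove-beyond (suc zero)    (a ∷ b ∷ [])    _          = refl
localMove-beyond (suc zero)    (a ∷ b ∷ c ∷ r) (s≤s (s≤s ()))
localMove-beyond (suc (suc j)) []              _          = refl
localMove-beyond (suc (suc j)) (a ∷ r)         (s≤s len≤) = cong (a ∷_) (localMove-beyond (suc j) r len≤)

localMove-applyUpTo : ∀ j m (F G : ℕ → Bool) → suc (suc j) < m →
                      (∀ q → q ≢ suc j → G q ≡ F q) →
                      G (suc j) ≡ F j xor F (suc j) xor F (suc (suc j)) →
                      localMove (suc j) (applyUpTo F m) ≡ applyUpTo G m
localMove-applyUpTo zero (suc zero) F G (s≤s ()) _ _
localMove-applyUpTo zero (suc (suc zero)) F G (s≤s (s≤s ())) _ _
localMove-applyUpTo zero (suc (suc (suc m))) F G _ G≗F G₁ =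
  cong₂ _∷_ (sym (G≗F 0 λ ())) (cong₂ _∷_ (sym G₁) (cong₂ _∷_ (sym (G≗F 2 λ ()))
    (applyUpTo-cong m (λ k _ → sym (G≗F (3 + k) λ ())))))
localMove-applyUpTo (suc j) (suc m) F G (s≤s j<m) G≗F Gⱼ =
  cong₂ _∷_ (sym (G≗F 0 λ ()))
    (localMove-applyUpTo j m (F ∘ suc) (G ∘ suc) j<m (λ q q≢ → G≗F (suc q) (q≢ ∘ suc-injective)) Gⱼ)

neighbourTerm : ℕ → ℕ → (ℕ → Bool) → ℕ → Bool
neighbourTerm n I F p =
  ((suc I ≡ᵇ p) ∨ (suc p ≡ᵇ I)) ∧ not (((I ≡ᵇ 0) ∧ (p ≡ᵇ 1)) ∨ ((I ≡ᵇ n) ∧ (p ≡ᵇ n ∸ 1))) ∧ F p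

neighbourSum : ℕ → ℕ → (ℕ → Bool) → Bool
neighbourSum n I F = xorUpTo (neighbourTerm n I F) (suc n)

movedAt : ℕ → ℕ → (ℕ → Bool) → ℕ → Bool
movedAt n I F q = if q ≡ᵇ I then F I xor neighbourSum n I F else F q

neighbourSum-start : ∀ n F → neighbourSum n 0 F ≡ false
neighbourSum-start n F = xorUpTo-false (suc n) term≡false
  where
  term≡false : ∀ p → p < suc n → neighbourTerm n 0 F p ≡ false
  term≡false zero          _ = refl
  term≡false (suc zero)    _ = refl
  term≡false (suc (suc p)) _ = refl

neighbourSum-end : ∀ j F → neighbourSum (suc j) (suc j) F ≡ false
neighbourSum-end j F = xorUpTo-false (suc (suc j)) term≡false
  where
  term≡false : ∀ p → p < suc (suc j) → neighbourTerm (suc j) (suc j) F p ≡ false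
  term≡false p p<
    rewrite ≡ᵇ-refl j | ≢⇒≡ᵇ-false {suc (suc j)} {p} (λ eq → <⇒≢ p< (sym eq)) with p ≡ᵇ j
  ... | true  = refl
  ... | false = refl

neighbourSum-interior : ∀ n j F → suc j < n → neighbourSum n (suc j) F ≡ F (suc (suc j)) xor F j
neighbourSum-interior n j F j<n = begin
  xorUpTo (neighbourTerm n (suc j) F) (suc n)                      ≡⟨ xorUpTo-cong (suc n) (λ p _ → term≡ p) ⟩
  xorUpTo (λ p → ((p ≡ᵇ suc (suc j)) ∧ F p) xor ((p ≡ᵇ j) ∧ F p)) (suc n)
    ≡⟨ xorUpTo-xor (suc n) (λ p → (p ≡ᵇ suc (suc j)) ∧ F p) (λ p → (p ≡ᵇ j) ∧ F p) ⟩
  xorUpTo (λ p → (p ≡ᵇ suc (suc j)) ∧ F p) (suc n) xor xorUpTo (λ p → (p ≡ᵇ j) ∧ F p) (suc n)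
    ≡⟨ cong₂ _xor_ (xorUpTo-select (suc n) (suc (suc j)) F (s≤s j<n))
                   (xorUpTo-select (suc n) j F (≤-trans (n≤1+n (suc j)) (≤-trans j<n (n≤1+n n)))) ⟩
  F (suc (suc j)) xor F j                                          ∎
  where
  open ≡-Reasoning
  term≡ : ∀ p → neighbourTerm n (suc j) F p ≡ ((p ≡ᵇ suc (suc j)) ∧ F p) xor ((p ≡ᵇ j) ∧ F p)
  term≡ p rewrite ≢⇒≡ᵇ-false (<⇒≢ j<n) | ≡ᵇ-sym (suc (suc j)) p
    with p ≡ᵇ suc (suc j) in p≡j+2 | p ≡ᵇ j in p≡j | F p
  ... | true  | true  | _     =
    ⊥-elim (<⇒≢ (n≤1+n (suc j)) (trans (sym (≡ᵇ-true⇒≡ {p} p≡j)) (≡ᵇ-true⇒≡ {p} p≡j+2)))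
  ... | true  | false | true  = refl
  ... | true  | false | false = refl
  ... | false | true  | true  = refl
  ... | false | true  | false = refl
  ... | false | false | _     = refl

movedAt-unchanged : ∀ n I F → neighbourSum n I F ≡ false → ∀ q → movedAt n I F q ≡ F q
movedAt-unchanged n I F sum≡0 q with q ≡ᵇ I in q≡I
... | true  rewrite sum≡0 = trans (xor-identityʳ (F I)) (cong F (sym (≡ᵇ-true⇒≡ q≡I)))
... | false = refl

localMove-Ctilde : ∀ n I F → I ≤ n → localMove I (applyUpTo F (suc n)) ≡ applyUpTo (movedAt n I F) (suc n)
localMove-Ctilde n zero F _ =
  applyUpTo-cong (suc n) (λ q _ → sym (movedAt-unchanged n 0 F (neighbourSum-start n F) q))
localMove-Ctilde n (suc j) F j<n with m≤n⇒m<n∨m≡n j<n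
... | inj₂ refl = trans (localMove-beyond (suc j) _ (≤-reflexive (length-applyUpTo F (suc n))))
                        (applyUpTo-cong (suc n) (λ q _ → sym (movedAt-unchanged n n F (neighbourSum-end j F) q)))
... | inj₁ j+1<n = localMove-applyUpTo j (suc n) F (movedAt n (suc j) F) (s≤s j+1<n) unchanged updated
  where
  unchanged : ∀ q → q ≢ suc j → movedAt n (suc j) F q ≡ F q
  unchanged q q≢ rewrite ≢⇒≡ᵇ-false q≢ = refl
  updated : movedAt n (suc j) F (suc j) ≡ F j xor F (suc j) xor F (suc (suc j))
  updated rewrite ≡ᵇ-refl j | neighbourSum-interior n j F j+1<n =
    x∙yz≈z∙xy (F (suc j)) (F (suc (suc j))) (F j)

toList-move : ∀ n (i : Fin (suc n)) c → toList (move (Ctilde n) i c) ≡ localMove (toℕ i) (toList c)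
toList-move n i c = begin
  toList (move (Ctilde n) i c)                        ≡⟨ toList-tabulate (suc n) (movedAt n (toℕ i) (at c)) entry ⟩
  applyUpTo (movedAt n (toℕ i) (at c)) (suc n)        ≡⟨ localMove-Ctilde n (toℕ i) (at c) (toℕ≤pred[n] i) ⟨
  localMove (toℕ i) (applyUpTo (at c) (suc n))        ≡⟨ cong (localMove (toℕ i)) (toList≡applyUpTo-at c) ⟨
  localMove (toℕ i) (toList c)                        ∎
  where
  open ≡-Reasoning
  G = Ctilde n
  entry : ∀ k → (if ⌊ k Fin.≟ i ⌋
                 then V.lookup c i xor xorSum (λ k′ → adj G i k′ ∧ not (dbl G i k′) ∧ V.lookup c k′)
                 else V.lookup c k)
               ≡ movedAt n (toℕ i) (at c) (toℕ k)
  entry k rewrite does-≟ k i | lookup≡at c i | lookup≡at c k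
    = cong (λ s → if toℕ k ≡ᵇ toℕ i then at c (toℕ i) xor s else at c (toℕ k))
           (xorSum≡xorUpTo (suc n) (neighbourTerm n (toℕ i) (at c))
              (λ k′ → cong (λ b → adj G i k′ ∧ not (dbl G i k′) ∧ b) (lookup≡at c k′)))

-- Differences and the class invariant

listWeight : List Bool → ℕ
listWeight []       = 0
listWeight (b ∷ bs) = (if b then 1 else 0) + listWeight bs

weight≡listWeight : ∀ {m} (c : Vec Bool m) → weight c ≡ listWeight (toList c)
weight≡listWeight []      = refl
weight≡listWeight (b ∷ c) = cong ((if b then 1 else 0) +_) (weight≡listWeight c)

listWeight≤length : ∀ bs → listWeight bs ≤ L.length bs
listWeight≤length []           = z≤n
listWeight≤length (true ∷ bs)  = s≤s (listWeight≤length bs)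
listWeight≤length (false ∷ bs) = ≤-trans (listWeight≤length bs) (n≤1+n _)

differences : List Bool → List Bool
differences (a ∷ b ∷ r) = (a xor b) ∷ differences (b ∷ r)
differences _           = []

integrate : Bool → List Bool → List Bool
integrate a []       = a ∷ []
integrate a (d ∷ ds) = a ∷ integrate (a xor d) ds

headOrFalse : List Bool → Bool
headOrFalse []      = false
headOrFalse (b ∷ _) = b

length-differences : ∀ a r → L.length (differences (a ∷ r)) ≡ L.length r
length-differences a []      = refl
length-differences a (b ∷ r) = cong suc (length-differences b r)

integrate-differences : ∀ a r → integrate a (differences (a ∷ r)) ≡ a ∷ r
integrate-differences a []      = refl
integrate-differences a (b ∷ r) =
  cong (a ∷_) (trans (cong (λ x → integrate x (differences (b ∷ r))) (xor-cancelˡ a b)) (integrate-differences b r))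

differences-integrate : ∀ a ds → differences (integrate a ds) ≡ ds
differences-integrate a []            = refl
differences-integrate a (d ∷ [])      = cong (_∷ []) (xor-cancelˡ a d)
differences-integrate a (d ∷ d′ ∷ ds) =
  cong₂ _∷_ (xor-cancelˡ a d) (differences-integrate (a xor d) (d′ ∷ ds))

headOrFalse-integrate : ∀ a ds → headOrFalse (integrate a ds) ≡ a
headOrFalse-integrate a []       = refl
headOrFalse-integrate a (d ∷ ds) = refl

swapAt : ℕ → List Bool → List Bool
swapAt zero    (x ∷ y ∷ r) = y ∷ x ∷ r
swapAt (suc j) (x ∷ r)     = x ∷ swapAt j r
swapAt _       l           = l

listWeight-swapAt : ∀ j ds → listWeight (swapAt j ds) ≡ listWeight ds
listWeight-swapAt zero    []          = refl
listWeight-swapAt zero    (x ∷ [])    = refl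
listWeight-swapAt zero    (true  ∷ true  ∷ r) = refl
listWeight-swapAt zero    (true  ∷ false ∷ r) = refl
listWeight-swapAt zero    (false ∷ true  ∷ r) = refl
listWeight-swapAt zero    (false ∷ false ∷ r) = refl
listWeight-swapAt (suc j) []          = refl
listWeight-swapAt (suc j) (x ∷ r)     = cong ((if x then 1 else 0) +_) (listWeight-swapAt j r)

length-swapAt : ∀ j ds → L.length (swapAt j ds) ≡ L.length ds
length-swapAt zero    []          = refl
length-swapAt zero    (x ∷ [])    = refl
length-swapAt zero    (x ∷ y ∷ r) = refl
length-swapAt (suc j) []          = refl
length-swapAt (suc j) (x ∷ r)     = cong suc (length-swapAt j r)

swapAt-beyond : ∀ j ds → L.length ds ≤ suc j → swapAt j ds ≡ ds
swapAt-beyond zero    []          _ = refl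
swapAt-beyond zero    (x ∷ [])    _ = refl
swapAt-beyond zero    (x ∷ y ∷ r) (s≤s ())
swapAt-beyond (suc j) []          _ = refl
swapAt-beyond (suc j) (x ∷ r)     (s≤s len≤) = cong (x ∷_) (swapAt-beyond j r len≤)

localMove-integrate : ∀ j a ds → localMove (suc j) (integrate a ds) ≡ integrate a (swapAt j ds)
localMove-integrate zero a []                 = refl
localMove-integrate zero a (d₁ ∷ [])          = refl
localMove-integrate zero a (d₁ ∷ d₂ ∷ [])     =
  cong₂ (λ x y → a ∷ x ∷ y ∷ []) (cong (a xor_) (xor-cancelˡ (a xor d₁) d₂)) (xy∙z≈xz∙y a d₁ d₂)
localMove-integrate zero a (d₁ ∷ d₂ ∷ d ∷ r) =
  cong₂ (λ x y → a ∷ x ∷ integrate y (d ∷ r)) (cong (a xor_) (xor-cancelˡ (a xor d₁) d₂)) (xy∙z≈xz∙y a d₁ d₂)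
localMove-integrate (suc j) a []       = cong (a ∷_) (localMove-beyond (suc j) [] z≤n)
localMove-integrate (suc j) a (d ∷ ds) = cong (a ∷_) (localMove-integrate j (a xor d) ds)

jumps : List Bool → ℕ
jumps l = listWeight (differences l)

invariant : List Bool → Bool × ℕ
invariant l = headOrFalse l , jumps l

invariant-localMove : ∀ I a r → invariant (localMove I (a ∷ r)) ≡ invariant (a ∷ r)
invariant-localMove zero    a r = refl
invariant-localMove (suc j) a r = begin
  invariant (localMove (suc j) (a ∷ r))          ≡⟨ cong (invariant ∘ localMove (suc j)) (integrate-differences a r) ⟨
  invariant (localMove (suc j) (integrate a D))  ≡⟨ cong invariant (localMove-integrate j a D) ⟩
  invariant (integrate a (swapAt j D))           ≡⟨ cong₂ _,_ (headOrFalse-integrate a (swapAt j D))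
                                                             (cong listWeight (differences-integrate a (swapAt j D))) ⟩
  (a , listWeight (swapAt j D))                  ≡⟨ cong (a ,_) (listWeight-swapAt j D) ⟩
  (a , listWeight D)                             ∎
  where
  open ≡-Reasoning
  D = differences (a ∷ r)

Swap : List Bool → List Bool → Set
Swap ds ds′ = ∃ λ j → ds′ ≡ swapAt j ds

sortedOf : ℕ → ℕ → List Bool
sortedOf w m = L.replicate w true L.++ L.replicate (m ∸ w) false

Star-Swap-∷ : ∀ x {ds ds′} → Star Swap ds ds′ → Star Swap (x ∷ ds) (x ∷ ds′)
Star-Swap-∷ x ε               = ε
Star-Swap-∷ x ((j , eq) ◅ ss) = (suc j , cong (x ∷_) eq) ◅ Star-Swap-∷ x ss

bubble : ∀ w rest → Star Swap (false ∷ L.replicate w true L.++ rest) (L.replicate w true L.++ false ∷ rest)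
bubble zero    rest = ε
bubble (suc w) rest = (0 , refl) ◅ Star-Swap-∷ true (bubble w rest)

sortBySwaps : ∀ ds → Star Swap ds (sortedOf (listWeight ds) (L.length ds))
sortBySwaps []           = ε
sortBySwaps (true ∷ ds)  = Star-Swap-∷ true (sortBySwaps ds)
sortBySwaps (false ∷ ds) =
  Star-Swap-∷ false (sortBySwaps ds) ◅◅
  subst (λ z → Star Swap (false ∷ sortedOf w (L.length ds)) (L.replicate w true L.++ L.replicate z false))
        (sym (+-∸-assoc 1 (listWeight≤length ds)))
        (bubble w (L.replicate (L.length ds ∸ w) false))
  where w = listWeight ds

Inv : ∀ {n} → Labeling (suc n) → Bool × ℕ
Inv c = invariant (toList c)

Inv-move : ∀ n (i : Fin (suc n)) c → Inv (move (Ctilde n) i c) ≡ Inv c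
Inv-move n i (x ∷ xs) = trans (cong invariant (toList-move n i (x ∷ xs))) (invariant-localMove (toℕ i) x (toList xs))

Inv-respects-∼ : ∀ {n} {c d : Labeling (suc n)} → c ∼⟨ Ctilde n ⟩ d → Inv c ≡ Inv d
Inv-respects-∼ {n} = gfold isEquivalence Inv λ { {c} (i , refl) → sym (Inv-move n i c) }

swaps⇒moves : ∀ n a {D E} → Star Swap D E → L.length D ≡ n → (c : Labeling (suc n)) →
              toList c ≡ integrate a D → ∃ λ c′ → toList c′ ≡ integrate a E × Star (Step (Ctilde n)) c c′
swaps⇒moves n a ε                    _   c c≡ = c , c≡ , ε
swaps⇒moves n a {D} ((j , refl) ◅ ss) len c c≡ with j <? n
... | yes j<n =
  let c′ , c′≡ , moves = swaps⇒moves n a ss (trans (length-swapAt j D) len) (move (Ctilde n) i c) moved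
  in  c′ , c′≡ , (i , refl) ◅ moves
  where
  i = fromℕ< (s≤s j<n)
  moved : toList (move (Ctilde n) i c) ≡ integrate a (swapAt j D)
  moved = trans (toList-move n i c) (trans (cong₂ localMove (toℕ-fromℕ< (s≤s j<n)) c≡) (localMove-integrate j a D))
... | no j≮n =
  swaps⇒moves n a ss (trans (length-swapAt j D) len) c (trans c≡ (cong (integrate a) (sym (swapAt-beyond j D short))))
  where
  short : L.length D ≤ suc j
  short = subst (_≤ suc j) (sym len) (≤-trans (≮⇒≥ j≮n) (n≤1+n j))

canonical : ℕ → Bool × ℕ → List Bool
canonical n (a , w) = integrate a (sortedOf w n)

reach-canonical : ∀ {n} (c : Labeling (suc n)) →
                  ∃ λ c′ → toList c′ ≡ canonical n (Inv c) × Star (Step (Ctilde n)) c c′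
reach-canonical {n} (x ∷ xs) =
  let c′ , c′≡ , moves = swaps⇒moves n x (sortBySwaps D) lenD (x ∷ xs) (sym (integrate-differences x (toList xs)))
  in  c′ , trans c′≡ (cong (λ m → integrate x (sortedOf (listWeight D) m)) lenD) , moves
  where
  D = differences (x ∷ toList xs)
  lenD : L.length D ≡ n
  lenD = trans (length-differences x (toList xs)) (length-toList xs)

Inv-complete : ∀ {n} (c d : Labeling (suc n)) → Inv c ≡ Inv d → c ∼⟨ Ctilde n ⟩ d
Inv-complete {n} c d Inv≡ =
  let c′ , c′≡ , c→c′ = reach-canonical c
      d′ , d′≡ , d→d′ = reach-canonical d
      c′≡d′ : c′ ≡ d′
      c′≡d′ = trans (sym (cast-is-id refl c′))
                (toList-injective refl c′ d′ (trans c′≡ (trans (cong (canonical n) Inv≡) (sym d′≡))))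
  in  Star.map fwd c→c′ ◅◅ subst (_∼⟨ Ctilde n ⟩ d) (sym c′≡d′) (symmetric (Step (Ctilde n)) (Star.map fwd d→d′))

jumps-bound : ∀ {n} (c : Labeling (suc n)) → proj₂ (Inv c) ≤ n
jumps-bound (x ∷ xs) = ≤-trans (listWeight≤length (differences (x ∷ toList xs)))
                               (≤-reflexive (trans (length-differences x (toList xs)) (length-toList xs)))

-- Minimal weight in a class

minWeight : Bool → ℕ → ℕ
minWeight false k = ⌈ k /2⌉
minWeight true  k = suc ⌊ k /2⌋

minWeight≤listWeight : ∀ a r → minWeight a (jumps (a ∷ r)) ≤ listWeight (a ∷ r)
minWeight≤listWeight false []           = z≤n
minWeight≤listWeight true  []           = s≤s z≤n
minWeight≤listWeight false (false ∷ r)  = minWeight≤listWeight false r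
minWeight≤listWeight false (true  ∷ r)  = minWeight≤listWeight true r
minWeight≤listWeight true  (false ∷ r)  = s≤s (minWeight≤listWeight false r)
minWeight≤listWeight true  (true  ∷ r)  = ≤-trans (minWeight≤listWeight true r) (n≤1+n _)

jumpless⇒all-true : ∀ r → jumps (true ∷ r) ≡ 0 → listWeight (true ∷ r) ≡ suc (L.length r)
jumpless⇒all-true []           _  = refl
jumpless⇒all-true (true ∷ r)   j≡0 = cong suc (jumpless⇒all-true r j≡0)
jumpless⇒all-true (false ∷ r)  ()

profile : ∀ {n} (c : Labeling (suc n)) → (Bool × ℕ) × ℕ
profile c = Inv c , weight c

profile-via-list : ∀ {n} (c : Labeling (suc n)) {l} → toList c ≡ l → profile c ≡ (invariant l , listWeight l)
profile-via-list c refl = cong (Inv c ,_) (weight≡listWeight c)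

Minimal : ∀ {n} → Labeling (suc n) → Set
Minimal {n} r = ∀ (c : Labeling (suc n)) → Inv c ≡ Inv r → weight r ≤ weight c

attains-minWeight⇒Minimal : ∀ {n} (r : Labeling (suc n)) {a k w} →
                            profile r ≡ ((a , k) , w) → w ≡ minWeight a k → Minimal r
attains-minWeight⇒Minimal r {a} {k} {w} prof w≡ (x ∷ xs) Inv≡ = begin
  weight r                             ≡⟨ trans (,-injectiveʳ prof) w≡ ⟩
  minWeight a k                        ≡⟨ cong (λ v → minWeight (proj₁ v) (proj₂ v)) (trans Inv≡ (,-injectiveˡ prof)) ⟨
  minWeight x (jumps (x ∷ toList xs))  ≤⟨ minWeight≤listWeight x (toList xs) ⟩
  listWeight (x ∷ toList xs)           ≡⟨ weight≡listWeight (x ∷ xs) ⟨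
  weight (x ∷ xs)                      ∎
  where open ≤-Reasoning

-- Alternating words

twice : ℕ → ℕ
twice zero    = zero
twice (suc i) = suc (suc (twice i))

2*≡twice : ∀ r → 2 * r ≡ twice r
2*≡twice zero    = refl
2*≡twice (suc r) = cong suc (trans (+-suc r (r + 0)) (cong suc (2*≡twice r)))

⌊twice/2⌋ : ∀ i → ⌊ twice i /2⌋ ≡ i
⌊twice/2⌋ zero    = refl
⌊twice/2⌋ (suc i) = cong suc (⌊twice/2⌋ i)

⌊suc-twice/2⌋ : ∀ i → ⌊ suc (twice i) /2⌋ ≡ i
⌊suc-twice/2⌋ zero    = refl
⌊suc-twice/2⌋ (suc i) = cong suc (⌊suc-twice/2⌋ i)

twice-%2 : ∀ i → twice i % 2 ≡ 0
twice-%2 zero    = refl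
twice-%2 (suc i) = twice-%2 i

suc-twice-%2 : ∀ i → suc (twice i) % 2 ≡ 1
suc-twice-%2 zero    = refl
suc-twice-%2 (suc i) = suc-twice-%2 i

twice-injective : ∀ {i j} → twice i ≡ twice j → i ≡ j
twice-injective {zero}  {zero}  _  = refl
twice-injective {suc i} {suc j} eq = cong suc (twice-injective (suc-injective (suc-injective eq)))

parity : ∀ k → (∃ λ i → k ≡ twice i) ⊎ (∃ λ i → k ≡ suc (twice i))
parity zero          = inj₁ (0 , refl)
parity (suc zero)    = inj₂ (0 , refl)
parity (suc (suc k)) with parity k
... | inj₁ (i , refl) = inj₁ (suc i , refl)
... | inj₂ (i , refl) = inj₂ (suc i , refl)

≤⌈/2⌉⇒twice≤ : ∀ m i → i ≤ ⌈ m /2⌉ → twice i ≤ suc m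
≤⌈/2⌉⇒twice≤ m             zero    _         = z≤n
≤⌈/2⌉⇒twice≤ zero          (suc i) ()
≤⌈/2⌉⇒twice≤ (suc zero)    (suc zero) _      = ≤-refl
≤⌈/2⌉⇒twice≤ (suc zero)    (suc (suc i)) (s≤s ())
≤⌈/2⌉⇒twice≤ (suc (suc m)) (suc i) (s≤s i≤) = s≤s (s≤s (≤⌈/2⌉⇒twice≤ m i i≤))

twice≤⇒≤⌈/2⌉ : ∀ m i → twice i ≤ suc m → i ≤ ⌈ m /2⌉
twice≤⇒≤⌈/2⌉ m             zero          _                 = z≤n
twice≤⇒≤⌈/2⌉ zero          (suc i)       (s≤s ())
twice≤⇒≤⌈/2⌉ (suc zero)    (suc zero)    _                 = s≤s z≤n
twice≤⇒≤⌈/2⌉ (suc zero)    (suc (suc i)) (s≤s (s≤s ()))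
twice≤⇒≤⌈/2⌉ (suc (suc m)) (suc i)       (s≤s (s≤s 2i≤)) = s≤s (twice≤⇒≤⌈/2⌉ m i 2i≤)

alternating : ℕ → ℕ → Bool
alternating r k = (k % 2 ≡ᵇ 0) ∧ (k <ᵇ twice r)

alternating-beyond : ∀ r k → twice r ≤ suc k → alternating r k ≡ false
alternating-beyond zero          k             _                 = ∧-zeroʳ _
alternating-beyond (suc r)       zero          (s≤s ())
alternating-beyond (suc r)       (suc zero)    _                 = refl
alternating-beyond (suc r)       (suc (suc k)) (s≤s (s≤s 2r≤k+1)) = alternating-beyond r k 2r≤k+1

alternating-via-successor : ∀ r k → (suc k % 2 ≡ᵇ 1) ∧ (k <ᵇ twice r ∸ 1) ≡ alternating r k
alternating-via-successor zero          k             = trans (∧-zeroʳ _) (sym (∧-zeroʳ _))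
alternating-via-successor (suc r)       zero          = refl
alternating-via-successor (suc r)       (suc zero)    = refl
alternating-via-successor (suc zero)    (suc (suc k)) = trans (∧-zeroʳ _) (sym (∧-zeroʳ _))
alternating-via-successor (suc (suc r)) (suc (suc k)) = alternating-via-successor (suc r) k

xi-suc : ∀ r m k → suc k ≤ m → xi r m (suc k) ≡ alternating r k
xi-suc r m k k<m rewrite T⇒≡true (≤⇒≤ᵇ k<m) | 2*≡twice r =
  trans (cong ((suc k % 2 ≡ᵇ 1) ∧_) (∧-identityʳ _)) (alternating-via-successor r k)

eta-inside : ∀ r m p → 1 ≤ p → p ≤ m → eta r m p ≡ alternating r (m ∸ p)
eta-inside r m p 1≤p p≤m rewrite T⇒≡true (≤⇒≤ᵇ 1≤p) | T⇒≡true (≤⇒≤ᵇ p≤m) | 2*≡twice r = refl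

alternate : ℕ → List Bool
alternate zero    = []
alternate (suc i) = true ∷ false ∷ alternate i

zeros : ℕ → List Bool
zeros m = L.replicate m false

applyUpTo-alternating : ∀ r m → twice r ≤ m → applyUpTo (alternating r) m ≡ alternate r L.++ zeros (m ∸ twice r)
applyUpTo-alternating zero    m _ = trans (applyUpTo-cong m (λ k _ → ∧-zeroʳ _)) (applyUpTo-const m false)
applyUpTo-alternating (suc r) (suc (suc m)) (s≤s (s≤s 2r≤m)) =
  cong (λ l → true ∷ false ∷ l) (applyUpTo-alternating r m 2r≤m)

alternateᴿ : ℕ → List Bool
alternateᴿ zero    = []
alternateᴿ (suc i) = false ∷ true ∷ alternateᴿ i

reverse-alternate : ∀ i → L.reverse (alternate i) ≡ alternateᴿ i
reverse-alternate zero    = refl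
reverse-alternate (suc i) = begin
  L.reverse (true ∷ false ∷ alternate i)              ≡⟨ unfold-reverse true (false ∷ alternate i) ⟩
  L.reverse (false ∷ alternate i) L.∷ʳ true           ≡⟨ cong (L._∷ʳ true) (unfold-reverse false (alternate i)) ⟩
  (L.reverse (alternate i) L.∷ʳ false) L.∷ʳ true      ≡⟨ cong (λ l → (l L.∷ʳ false) L.∷ʳ true) (reverse-alternate i) ⟩
  (alternateᴿ i L.∷ʳ false) L.∷ʳ true                 ≡⟨ snoc-false-true i ⟩
  false ∷ true ∷ alternateᴿ i                         ∎
  where
  open ≡-Reasoning
  snoc-false-true : ∀ i → (alternateᴿ i L.∷ʳ false) L.∷ʳ true ≡ false ∷ true ∷ alternateᴿ i
  snoc-false-true zero    = refl
  snoc-false-true (suc i) = cong (λ l → false ∷ true ∷ l) (snoc-false-true i)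

replicate-++-∷ : ∀ {A : Set} m (x : A) l → L.replicate m x L.++ x ∷ l ≡ x ∷ L.replicate m x L.++ l
replicate-++-∷ zero    x l = refl
replicate-++-∷ (suc m) x l = cong (x ∷_) (replicate-++-∷ m x l)

reverse-replicate : ∀ {A : Set} m (x : A) → L.reverse (L.replicate m x) ≡ L.replicate m x
reverse-replicate zero    x = refl
reverse-replicate (suc m) x = begin
  L.reverse (x ∷ L.replicate m x)       ≡⟨ unfold-reverse x (L.replicate m x) ⟩
  L.reverse (L.replicate m x) L.∷ʳ x    ≡⟨ cong (L._∷ʳ x) (reverse-replicate m x) ⟩
  L.replicate m x L.++ x ∷ []           ≡⟨ replicate-++-∷ m x [] ⟩
  x ∷ L.replicate m x L.++ []           ≡⟨ cong (x ∷_) (++-identityʳ (L.replicate m x)) ⟩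
  x ∷ L.replicate m x                   ∎
  where open ≡-Reasoning

jumps-false∷alternate : ∀ i l → jumps (false ∷ alternate i L.++ l) ≡ twice i + jumps (false ∷ l)
jumps-false∷alternate zero    l = refl
jumps-false∷alternate (suc i) l = cong (suc ∘ suc) (jumps-false∷alternate i l)

jumps-false∷zeros : ∀ m l → jumps (false ∷ zeros m L.++ l) ≡ jumps (false ∷ l)
jumps-false∷zeros zero    l = refl
jumps-false∷zeros (suc m) l = jumps-false∷zeros m l

jumps-true∷alternateᴿ : ∀ i → jumps (true ∷ alternateᴿ i) ≡ twice i
jumps-true∷alternateᴿ zero    = refl
jumps-true∷alternateᴿ (suc i) = cong (suc ∘ suc) (jumps-true∷alternateᴿ i)

jumps-replicate : ∀ m b → jumps (L.replicate m b) ≡ 0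
jumps-replicate zero          b = refl
jumps-replicate (suc zero)    b = refl
jumps-replicate (suc (suc m)) b =
  trans (cong (λ x → (if x then 1 else 0) + jumps (L.replicate (suc m) b)) (xor-same b)) (jumps-replicate (suc m) b)

jumps-false∷alternate++zeros : ∀ i m → jumps (false ∷ alternate i L.++ zeros m) ≡ twice i
jumps-false∷alternate++zeros i m =
  trans (jumps-false∷alternate i (zeros m)) (trans (cong (twice i +_) (jumps-replicate (suc m) false)) (+-identityʳ _))

listWeight-alternate : ∀ i l → listWeight (alternate i L.++ l) ≡ i + listWeight l
listWeight-alternate zero    l = refl
listWeight-alternate (suc i) l = cong suc (listWeight-alternate i l)

listWeight-zeros : ∀ m → listWeight (zeros m) ≡ 0
listWeight-zeros zero    = refl
listWeight-zeros (suc m) = listWeight-zeros m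

listWeight-zeros++ : ∀ m l → listWeight (zeros m L.++ l) ≡ listWeight l
listWeight-zeros++ zero    l = refl
listWeight-zeros++ (suc m) l = listWeight-zeros++ m l

listWeight-alternate++zeros : ∀ i m → listWeight (alternate i L.++ zeros m) ≡ i
listWeight-alternate++zeros i m =
  trans (listWeight-alternate i (zeros m)) (trans (cong (i +_) (listWeight-zeros m)) (+-identityʳ i))

listWeight-alternateᴿ : ∀ i → listWeight (alternateᴿ i) ≡ i
listWeight-alternateᴿ zero    = refl
listWeight-alternateᴿ (suc i) = cong suc (listWeight-alternateᴿ i)

listWeight-replicate-true : ∀ m → listWeight (L.replicate m true) ≡ m
listWeight-replicate-true zero    = refl
listWeight-replicate-true (suc m) = cong suc (listWeight-replicate-true m)

-- The representatives

-- The entries of rep1 … rep4 as functions of the vertex, restated from Defs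
-- because unification cannot recover them from the tabulated vectors.
rep1At rep2At rep3At rep4At : ℕ → ℕ → ℕ → Bool
rep1At n i j = if (j ≡ᵇ 0) ∨ (j ≡ᵇ n) then false else xi i (n ∸ 1) j
rep2At n i j = if j ≡ᵇ 0 then false else if j ≡ᵇ n then true else if j ≡ᵇ n ∸ 1 then false else eta i (n ∸ 2) j
rep3At n i j = if j ≡ᵇ 0 then true else if j ≡ᵇ n then false else if j ≡ᵇ 1 then false else xi i (n ∸ 2) (j ∸ 1)
rep4At n i j = if (j ≡ᵇ 0) ∨ (j ≡ᵇ n) then true else if (j ≡ᵇ 1) ∨ (j ≡ᵇ n ∸ 1) then false else xi i (n ∸ 3) (j ∸ 1)

toList-rep1 : ∀ n i → twice i ≤ n → toList (rep1 n i) ≡ false ∷ alternate i L.++ zeros (n ∸ twice i)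
toList-rep1 n i 2i≤n =
  trans (toList-mkLab n (rep1At n i)) (cong (false ∷_) (trans (applyUpTo-cong n entry) (applyUpTo-alternating i n 2i≤n)))
  where
  entry : ∀ k → k < n → rep1At n i (suc k) ≡ alternating i k
  entry k k<n with suc k ≟ n
  ... | yes refl rewrite ≡ᵇ-refl k = sym (alternating-beyond i k 2i≤n)
  ... | no k+1≢n rewrite ≢⇒≡ᵇ-false k+1≢n = xi-suc i (n ∸ 1) k (∸-monoˡ-≤ 1 (≤∧≢⇒< k<n k+1≢n))

toList-rep3 : ∀ n i → suc (twice i) ≤ n → toList (rep3 n i) ≡ applyUpTo (alternating (suc i)) (suc n)
toList-rep3 n i 2i<n = trans (toList-mkLab n (rep3At n i)) (applyUpTo-cong (suc n) entry)
  where
  entry : ∀ j → j < suc n → rep3At n i j ≡ alternating (suc i) j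
  entry zero          _ = refl
  entry (suc zero)    _ = if-same (1 ≡ᵇ n) false
  entry (suc (suc k)) j<n+1 with suc (suc k) ≟ n
  ... | yes refl rewrite ≡ᵇ-refl k = sym (alternating-beyond i k (s≤s⁻¹ 2i<n))
  ... | no j≢n   rewrite ≢⇒≡ᵇ-false j≢n = xi-suc i (n ∸ 2) k (∸-monoˡ-≤ 2 (≤∧≢⇒< (s≤s⁻¹ j<n+1) j≢n))

toList-rep3-explicit : ∀ n i → suc (twice i) ≤ n →
                       toList (rep3 n i) ≡ alternate (suc i) L.++ zeros (n ∸ suc (twice i))
toList-rep3-explicit n i 2i<n = trans (toList-rep3 n i 2i<n) (applyUpTo-alternating (suc i) (suc n) (s≤s 2i<n))

rep2At-reflects-rep3 : ∀ i j d → suc (twice i) ≤ j + d → rep2At (j + d) i j ≡ alternating (suc i) d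
rep2At-reflects-rep3 i zero d 2i<n = sym (alternating-beyond (suc i) d (s≤s 2i<n))
rep2At-reflects-rep3 i (suc j) zero _ rewrite +-identityʳ j | ≡ᵇ-refl j = refl
rep2At-reflects-rep3 i (suc j) (suc zero) _
  rewrite +-comm j 1 | ≢⇒≡ᵇ-false (<⇒≢ (n<1+n j)) | ≡ᵇ-refl j = refl
rep2At-reflects-rep3 i (suc j) (suc (suc d)) _
  rewrite +-suc j (suc d) | +-suc j d
        | ≢⇒≡ᵇ-false (<⇒≢ (m<n⇒m<1+n (s≤s (m≤m+n j d)))) | ≢⇒≡ᵇ-false (m≢1+m+n j {d}) =
  trans (eta-inside i (suc (j + d)) (suc j) (s≤s z≤n) (s≤s (m≤m+n j d))) (cong (alternating i) (m+n∸m≡n j d))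

toList-rep2 : ∀ n i → suc (twice i) ≤ n → toList (rep2 n i) ≡ L.reverse (toList (rep3 n i))
toList-rep2 n i 2i<n = begin
  toList (rep2 n i)                                         ≡⟨ toList-mkLab n (rep2At n i) ⟩
  applyUpTo (rep2At n i) (suc n)                            ≡⟨ applyUpTo-cong (suc n) entry ⟩
  applyUpTo (λ j → alternating (suc i) (n ∸ j)) (suc n)     ≡⟨ applyDownFrom≡applyUpTo (alternating (suc i)) (suc n) ⟨
  L.applyDownFrom (alternating (suc i)) (suc n)             ≡⟨ reverse-applyUpTo (alternating (suc i)) (suc n) ⟨
  L.reverse (applyUpTo (alternating (suc i)) (suc n))       ≡⟨ cong L.reverse (toList-rep3 n i 2i<n) ⟨
  L.reverse (toList (rep3 n i))                             ∎
  where
  open ≡-Reasoning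
  entry : ∀ j → j < suc n → rep2At n i j ≡ alternating (suc i) (n ∸ j)
  entry j j≤n = subst (λ m → rep2At m i j ≡ alternating (suc i) (n ∸ j)) j+[n∸j]≡n
                  (rep2At-reflects-rep3 i j (n ∸ j) (subst (suc (twice i) ≤_) (sym j+[n∸j]≡n) 2i<n))
    where j+[n∸j]≡n = m+[n∸m]≡n (s≤s⁻¹ j≤n)

toList-rep4 : ∀ n i → suc (suc (twice i)) ≤ n → toList (rep4 n i) ≡ applyUpTo (alternating (suc i)) n L.∷ʳ true
toList-rep4 n i 2i+1<n =
  trans (toList-mkLab n (rep4At n i))
    (trans (sym (applyUpTo-∷ʳ (rep4At n i) n)) (cong₂ L._∷ʳ_ (applyUpTo-cong n entry) last))
  where
  last : rep4At n i n ≡ true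
  last rewrite ≡ᵇ-refl n | ∨-zeroʳ (n ≡ᵇ 0) = refl
  entry : ∀ j → j < n → rep4At n i j ≡ alternating (suc i) j
  entry zero          _   = refl
  entry (suc zero)    1<n rewrite ≢⇒≡ᵇ-false (<⇒≢ 1<n) = refl
  entry (suc (suc k)) j<n rewrite ≢⇒≡ᵇ-false (<⇒≢ j<n) with suc (suc k) ≟ n ∸ 1
  ... | yes j≡n-1 rewrite ≡⇒≡ᵇ-true j≡n-1 =
    sym (alternating-beyond i k (s≤s⁻¹ (subst (suc (twice i) ≤_) (sym j≡n-1) (∸-monoˡ-≤ 1 2i+1<n))))
  ... | no  j≢n-1 rewrite ≢⇒≡ᵇ-false j≢n-1 =
    xi-suc i (n ∸ 3) k (subst (suc k ≤_) (∸-+-assoc n 1 2) (∸-monoˡ-≤ 2 (≤∧≢⇒< (∸-monoˡ-≤ 1 j<n) j≢n-1)))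

toList-rep5 : ∀ n → toList (rep5 n) ≡ L.replicate (suc n) true
toList-rep5 n = trans (toList-mkLab n (λ _ → true)) (applyUpTo-const (suc n) true)

profile-rep1 : ∀ n i → twice i ≤ n → profile (rep1 n i) ≡ ((false , twice i) , i)
profile-rep1 n i 2i≤n = trans (profile-via-list (rep1 n i) (toList-rep1 n i 2i≤n))
  (cong₂ (λ k w → ((false , k) , w))
    (jumps-false∷alternate++zeros i m)
    (listWeight-alternate++zeros i m))
  where m = n ∸ twice i

profile-rep2 : ∀ n i → suc (twice i) ≤ n → profile (rep2 n i) ≡ ((false , suc (twice i)) , suc i)
profile-rep2 n i 2i<n = trans (profile-via-list (rep2 n i) list)
  (cong₂ (λ k w → ((false , k) , w))
    (trans (jumps-false∷zeros m (true ∷ alternateᴿ i)) (cong suc (jumps-true∷alternateᴿ i)))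
    (trans (listWeight-zeros++ m (true ∷ alternateᴿ i)) (cong suc (listWeight-alternateᴿ i))))
  where
  m = n ∸ suc (twice i)
  open ≡-Reasoning
  list : toList (rep2 n i) ≡ false ∷ zeros m L.++ true ∷ alternateᴿ i
  list = begin
    toList (rep2 n i)                                           ≡⟨ toList-rep2 n i 2i<n ⟩
    L.reverse (toList (rep3 n i))                               ≡⟨ cong L.reverse (toList-rep3-explicit n i 2i<n) ⟩
    L.reverse (alternate (suc i) L.++ zeros m)                  ≡⟨ reverse-++ (alternate (suc i)) (zeros m) ⟩
    L.reverse (zeros m) L.++ L.reverse (alternate (suc i))      ≡⟨ cong₂ L._++_ (reverse-replicate m false) (reverse-alternate (suc i)) ⟩
    zeros m L.++ false ∷ true ∷ alternateᴿ i                    ≡⟨ replicate-++-∷ m false (true ∷ alternateᴿ i) ⟩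
    false ∷ zeros m L.++ true ∷ alternateᴿ i                    ∎

profile-rep3 : ∀ n i → suc (twice i) ≤ n → profile (rep3 n i) ≡ ((true , suc (twice i)) , suc i)
profile-rep3 n i 2i<n = trans (profile-via-list (rep3 n i) (toList-rep3-explicit n i 2i<n))
  (cong₂ (λ k w → ((true , k) , w))
    (cong suc (jumps-false∷alternate++zeros i m))
    (listWeight-alternate++zeros (suc i) m))
  where m = n ∸ suc (twice i)

profile-rep4 : ∀ n i → suc (suc (twice i)) ≤ n → profile (rep4 n i) ≡ ((true , suc (suc (twice i))) , suc (suc i))
profile-rep4 n i 2i+1<n = trans (profile-via-list (rep4 n i) list) (cong₂ (λ k w → ((true , suc k) , suc w)) jumps≡ weight≡)
  where
  m = n ∸ suc (suc (twice i))
  tail = zeros m L.++ true ∷ []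
  list : toList (rep4 n i) ≡ alternate (suc i) L.++ tail
  list = trans (toList-rep4 n i 2i+1<n)
           (trans (cong (L._∷ʳ true) (applyUpTo-alternating (suc i) n 2i+1<n)) (++-assoc (alternate (suc i)) (zeros m) (true ∷ [])))
  jumps≡ : jumps (false ∷ alternate i L.++ tail) ≡ suc (twice i)
  jumps≡ = trans (jumps-false∷alternate i tail) (trans (cong (twice i +_) (jumps-false∷zeros m (true ∷ []))) (+-comm (twice i) 1))
  weight≡ : listWeight (alternate i L.++ tail) ≡ suc i
  weight≡ = trans (listWeight-alternate i tail) (trans (cong (i +_) (listWeight-zeros++ m (true ∷ []))) (+-comm i 1))

profile-rep5 : ∀ n → profile (rep5 n) ≡ ((true , 0) , suc n)
profile-rep5 n = trans (profile-via-list (rep5 n) (toList-rep5 n))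
  (cong₂ (λ k w → ((true , k) , w)) (jumps-replicate (suc n) true) (listWeight-replicate-true (suc n)))

Minimal-rep5 : ∀ n → Minimal (rep5 n)
Minimal-rep5 n (x ∷ xs) Inv≡ with ,-injectiveˡ (trans Inv≡ (,-injectiveˡ (profile-rep5 n)))
... | refl = ≤-reflexive (begin
  weight (rep5 n)              ≡⟨ ,-injectiveʳ (profile-rep5 n) ⟩
  suc n                        ≡⟨ cong suc (length-toList xs) ⟨
  suc (L.length (toList xs))   ≡⟨ jumpless⇒all-true (toList xs) (,-injectiveʳ (trans Inv≡ (,-injectiveˡ (profile-rep5 n)))) ⟨
  listWeight (true ∷ toList xs) ≡⟨ weight≡listWeight (true ∷ xs) ⟨
  weight (true ∷ xs)           ∎)
  where open ≡-Reasoning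

-- Counting the classes

-- Constant on each of the five families of representatives, increasing along reps.
kind : Bool × ℕ → ℕ
kind (false , k)     = suc (k % 2)
kind (true  , zero)  = 5
kind (true  , suc k) = 3 + k % 2

module Classification (m : ℕ) where

  n : ℕ
  n = 3 + m

  A₁ A₂ A₄ : ℕ
  A₁ = suc ⌈ n ∸ 1 /2⌉
  A₂ = suc ⌈ n ∸ 2 /2⌉
  A₄ = suc ⌈ n ∸ 3 /2⌉

  block₁ block₂ block₃ block₄ : List (Labeling (suc n))
  block₁ = L.map (rep1 n) (L.upTo A₁)
  block₂ = L.map (rep2 n) (L.upTo A₂)
  block₃ = L.map (rep3 n) (L.upTo A₂)
  block₄ = L.map (rep4 n) (L.upTo A₄)

  bound₁ : ∀ {i} → i < A₁ → twice i ≤ n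
  bound₁ {i} i<A = ≤⌈/2⌉⇒twice≤ (2 + m) i (s≤s⁻¹ i<A)

  bound₂ : ∀ {i} → i < A₂ → suc (twice i) ≤ n
  bound₂ {i} i<A = s≤s (≤⌈/2⌉⇒twice≤ (1 + m) i (s≤s⁻¹ i<A))

  bound₄ : ∀ {i} → i < A₄ → suc (suc (twice i)) ≤ n
  bound₄ {i} i<A = s≤s (s≤s (≤⌈/2⌉⇒twice≤ m i (s≤s⁻¹ i<A)))

  length-reps : L.length (reps n) ≡ 2 * n + 2
  length-reps = begin
    L.length (reps n)                                ≡⟨ lengths ⟩
    A₁ + (A₂ + (A₂ + (A₄ + 1)))                      ≡⟨ count ⌈ m /2⌉ ⌈ suc m /2⌉ ⟩
    2 * (2 + (⌈ m /2⌉ + ⌈ suc m /2⌉)) + 2            ≡⟨ cong (λ s → 2 * (2 + s) + 2) (⌊n/2⌋+⌈n/2⌉≡n (suc m)) ⟩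
    2 * n + 2                                        ∎
    where
    open ≡-Reasoning
    count : ∀ c d → suc (suc c) + (suc d + (suc d + (suc c + 1))) ≡ 2 * (2 + (c + d)) + 2
    count = solve-∀
    lengths : L.length (reps n) ≡ A₁ + (A₂ + (A₂ + (A₄ + 1)))
    lengths =
      trans (length-++ block₁) (cong₂ _+_ (length-map-upTo (rep1 n) A₁)
      (trans (length-++ block₂) (cong₂ _+_ (length-map-upTo (rep2 n) A₂)
      (trans (length-++ block₃) (cong₂ _+_ (length-map-upTo (rep3 n) A₂)
      (trans (length-++ block₄) (cong (_+ 1) (length-map-upTo (rep4 n) A₄))))))))

  Distinct : Labeling (suc n) → Labeling (suc n) → Set
  Distinct x y = Inv x ≢ Inv y

  Block : ℕ → List (Labeling (suc n)) → Set
  Block b xs = AllPairs Distinct xs × All (λ x → kind (Inv x) ≡ b) xs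

  Separated : ℕ → List (Labeling (suc n)) → Set
  Separated b xs = AllPairs Distinct xs × All (λ x → b ≤ kind (Inv x)) xs

  Block-upTo : ∀ b (f : ℕ → Labeling (suc n)) N (v : ℕ → Bool × ℕ) → (∀ {i} → i < N → Inv (f i) ≡ v i) →
               (∀ {i j} → v i ≡ v j → i ≡ j) → (∀ i → kind (v i) ≡ b) → Block b (L.map f (L.upTo N))
  Block-upTo b f N v Inv≡ v-injective kind≡ =
    AllPairs-upTo Inv f N (λ i<N j<N eq → v-injective (trans (sym (Inv≡ i<N)) (trans eq (Inv≡ j<N)))) ,
    All-upTo _ f N (λ i i<N → trans (cong kind (Inv≡ i<N)) (kind≡ i))

  Separated-++ : ∀ b {xs ys} → Block b xs → Separated (suc b) ys → Separated b (xs L.++ ys)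
  Separated-++ b (dxs , kxs) (dys , kys) =
    APP.++⁺ dxs dys (All.map (λ kx≡b → All.map (λ b<ky Inv≡ → <⇒≢ b<ky (trans (sym kx≡b) (cong kind Inv≡))) kys) kxs) ,
    AllP.++⁺ (All.map (≤-reflexive ∘ sym) kxs) (All.map <⇒≤ kys)

  separated-reps : Separated 1 (reps n)
  separated-reps =
    Separated-++ 1 (Block-upTo 1 (rep1 n) A₁ (λ i → false , twice i)
                      (λ i<A → ,-injectiveˡ (profile-rep1 n _ (bound₁ i<A)))
                      (twice-injective ∘ ,-injectiveʳ) (λ i → cong suc (twice-%2 i)))
   (Separated-++ 2 (Block-upTo 2 (rep2 n) A₂ (λ i → false , suc (twice i))
                      (λ i<A → ,-injectiveˡ (profile-rep2 n _ (bound₂ i<A)))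
                      (twice-injective ∘ suc-injective ∘ ,-injectiveʳ) (λ i → cong suc (suc-twice-%2 i)))
   (Separated-++ 3 (Block-upTo 3 (rep3 n) A₂ (λ i → true , suc (twice i))
                      (λ i<A → ,-injectiveˡ (profile-rep3 n _ (bound₂ i<A)))
                      (twice-injective ∘ suc-injective ∘ ,-injectiveʳ) (λ i → cong (3 +_) (twice-%2 i)))
   (Separated-++ 4 (Block-upTo 4 (rep4 n) A₄ (λ i → true , suc (suc (twice i)))
                      (λ i<A → ,-injectiveˡ (profile-rep4 n _ (bound₄ i<A)))
                      (twice-injective ∘ suc-injective ∘ suc-injective ∘ ,-injectiveʳ) (λ i → cong (3 +_) (suc-twice-%2 i)))
   (All.[] AP.∷ AP.[] , ≤-reflexive (sym (cong kind (,-injectiveˡ (profile-rep5 n)))) All.∷ All.[]))))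

  represented : ∀ a k → k ≤ n → Any (λ r → Inv r ≡ (a , k)) (reps n)
  represented false k k≤n with parity k
  ... | inj₁ (i , refl) =
    AnyP.++⁺ˡ (Any-upTo _ (rep1 n) i (s≤s (twice≤⇒≤⌈/2⌉ (2 + m) i k≤n)) (,-injectiveˡ (profile-rep1 n i k≤n)))
  ... | inj₂ (i , refl) = AnyP.++⁺ʳ block₁ (AnyP.++⁺ˡ
    (Any-upTo _ (rep2 n) i (s≤s (twice≤⇒≤⌈/2⌉ (1 + m) i (s≤s⁻¹ k≤n))) (,-injectiveˡ (profile-rep2 n i k≤n))))
  represented true zero _ = AnyP.++⁺ʳ block₁ (AnyP.++⁺ʳ block₂ (AnyP.++⁺ʳ block₃ (AnyP.++⁺ʳ block₄
    (here (,-injectiveˡ (profile-rep5 n))))))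
  represented true (suc k) k<n with parity k
  ... | inj₁ (i , refl) = AnyP.++⁺ʳ block₁ (AnyP.++⁺ʳ block₂ (AnyP.++⁺ˡ
    (Any-upTo _ (rep3 n) i (s≤s (twice≤⇒≤⌈/2⌉ (1 + m) i (s≤s⁻¹ k<n))) (,-injectiveˡ (profile-rep3 n i k<n)))))
  ... | inj₂ (i , refl) = AnyP.++⁺ʳ block₁ (AnyP.++⁺ʳ block₂ (AnyP.++⁺ʳ block₃ (AnyP.++⁺ˡ
    (Any-upTo _ (rep4 n) i (s≤s (twice≤⇒≤⌈/2⌉ m i (s≤s⁻¹ (s≤s⁻¹ k<n)))) (,-injectiveˡ (profile-rep4 n i k<n))))))

  minimal-reps : All Minimal (reps n)
  minimal-reps =
    AllP.++⁺ (All-upTo Minimal (rep1 n) A₁ λ i i<A →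
      attains-minWeight⇒Minimal (rep1 n i) (profile-rep1 n i (bound₁ i<A)) (sym (⌊suc-twice/2⌋ i)))
   (AllP.++⁺ (All-upTo Minimal (rep2 n) A₂ λ i i<A →
      attains-minWeight⇒Minimal (rep2 n i) (profile-rep2 n i (bound₂ i<A)) (cong suc (sym (⌊twice/2⌋ i))))
   (AllP.++⁺ (All-upTo Minimal (rep3 n) A₂ λ i i<A →
      attains-minWeight⇒Minimal (rep3 n i) (profile-rep3 n i (bound₂ i<A)) (cong suc (sym (⌊suc-twice/2⌋ i))))
   (AllP.++⁺ (All-upTo Minimal (rep4 n) A₄ λ i i<A →
      attains-minWeight⇒Minimal (rep4 n i) (profile-rep4 n i (bound₄ i<A)) (cong (suc ∘ suc) (sym (⌊twice/2⌋ i))))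
   (Minimal-rep5 n All.∷ All.[]))))

  representative : ∀ c → ∃ λ (i : Fin (L.length (reps n))) → c ∼⟨ Ctilde n ⟩ L.lookup (reps n) i
  representative c = Any.index p , Inv-complete c _ (sym (AnyP.lookup-index p))
    where p = represented (proj₁ (Inv c)) (proj₂ (Inv c)) (jumps-bound c)

proposition2p32 : (n : ℕ) → 3 ≤ n →
    (length (reps n) ≡ 2 * n + 2)
  × (∀ c → ∃ λ (i : Fin (length (reps n))) → c ∼⟨ Ctilde n ⟩ lookup (reps n) i)
  × (∀ (i j : Fin (length (reps n))) →
       lookup (reps n) i ∼⟨ Ctilde n ⟩ lookup (reps n) j → i ≡ j)
  × (∀ (i : Fin (length (reps n))) c →
       c ∼⟨ Ctilde n ⟩ lookup (reps n) i → weight (lookup (reps n) i) ≤ weight c)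
proposition2p32 zero                ()
proposition2p32 (suc zero)          (s≤s ())
proposition2p32 (suc (suc zero))    (s≤s (s≤s ()))
proposition2p32 (suc (suc (suc m))) _ =
    length-reps
  , representative
  , (λ i j i∼j → lookup-injective Inv (proj₁ separated-reps) i j (Inv-respects-∼ i∼j))
  , (λ i c c∼i → All.lookup minimal-reps (∈-lookup i) c (Inv-respects-∼ c∼i))
  where open Classification m
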